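{- For every permutation $\theta$ of the atoms $I$ (an isomorphism), every $k$-form $\varphi$ and every $k$-molecule $\sigma$ we have $\theta(\varphi*\sigma)=\varphi*^{\theta}\theta\sigma$.
   Context: $I$ is a finite set of atoms partitioned into a set $C$ of colours. Permutations $\theta$ of $I$ act on hereditarily finite sets elementwise; $\theta(C)=\{\theta(c)\mid c\in C\}$ is again a partition of $I$. Fix $k\ge1$. A $k$-molecule is an injective $\sigma:\{0,\dots,k-1\}\to I$; $\theta\sigma=\theta\circ\sigma$. For molecules $\tau,\sigma$ (with $\rho_0=\tau$, $\rho_1=\sigma$): $\textit{conf}(\tau,\sigma)=(\sim,col)$ where $(i,p)\sim(j,q)$ iff $\rho_i(p)=\rho_j(q)$ and $col(i,p)=c\in C$ iff $\rho_i(p)\in c$; and $\textit{conf}^{\theta}(\tau,\sigma)=(\sim,col^\theta)$ with the same $\sim$ and $col^\theta(i,p)=\theta(c)$ iff $\rho_i(p)\in\theta(c)$. An abstract 2-configuration is $(\sim,col)$ with $\sim$ an equivalence on $\{0,1\}\times\{0,\dots,k-1\}$ such that $(i,p)\sim(i,q)\iff p=q$ and $col$ into $C$ constant on classes; for such $E=(\sim,col)$, $\theta(E)=(\sim,\theta\circ col)$. The $k$-forms are the smallest set containing symbols $c_0,\dots,c_{k-1}$ and all finite sets $\{(\varphi_1,E_1),\dots,(\varphi_n,E_n)\}$ with $\varphi_i$ $k$-forms and $E_i$ abstract 2-configurations. Define $c_p*\sigma=\sigma(p)$ and $\{(\varphi_i,E_i)\}*\sigma=\{\varphi_i*\tau\mid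 1\le i\le n,\ E_i=\textit{conf}(\tau,\sigma)\}$; and $c_p*^{\theta}\sigma=\sigma(p)$, $\{(\varphi_i,E_i)\}*^{\theta}\sigma=\{\varphi_i*^{\theta}\tau\mid 1\le i\le n,\ \theta(E_i)=\textit{conf}^{\theta}(\tau,\sigma)\}$ (with $\tau$ ranging over $k$-molecules). -}

module Defs where

open import Data.Nat using (ℕ; zero; suc)
open import Data.Fin using (Fin; zero; suc)
open import Data.Fin.Properties using (all?)
open import Data.Fin.Subset using (Subset; Nonempty) renaming (⊥ to ∅)
open import Data.Fin.Permutation using (Permutation′; _⟨$⟩ʳ_; _⟨$⟩ˡ_)
open import Data.Bool using (Bool; true; false)
import Data.Bool.Properties as BoolP
open import Data.Vec using (Vec; lookup; tabulate)
open import Data.Vec.Properties using (≡-dec)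
open import Data.List using (List; []; _∷_; _++_; map; filter; concatMap; allFin)
open import Data.List.Membership.Propositional using (_∈_)
open import Data.List.Relation.Unary.All using (All)
open import Data.List.Relation.Unary.Any using (Any)
open import Data.Product using (_×_; _,_; ∃)
open import Function.Bundles using (_⇔_)
open import Relation.Nullary using (Dec; does)
open import Relation.Nullary.Decidable using (_×-dec_; _→-dec_)
open import Relation.Binary.PropositionalEquality using (_≡_)
import Data.Fin.Properties as FinP

-- Atoms, colours, permutations
--   The finite set of atoms I is Fin n.  A colour is a subset of I
--   (a characteristic vector).  A set C of colours is a list of colours.

Colour : ℕ → Set
Colour n = Subset n

_∈c_ : ∀ {n} → Fin n → Colour n → Set
i ∈c c = lookup c i ≡ true

IsPartition : ∀ {n} → List (Colour n) → Set
IsPartition {n} C =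
  All Nonempty C ×
  ((i : Fin n) → ∃ λ c → c ∈ C × i ∈c c) ×
  ((i : Fin n) (c c′ : Colour n) → c ∈ C → c′ ∈ C → i ∈c c → i ∈c c′ → c ≡ c′)

actC : ∀ {n} → Permutation′ n → Colour n → Colour n
actC θ c = tabulate (λ j → lookup c (θ ⟨$⟩ˡ j))

actCs : ∀ {n} → Permutation′ n → List (Colour n) → List (Colour n)
actCs θ C = map (actC θ) C

-- the block of the colour list D containing atom i
-- (unique when D is a partition; the default ∅ is never used then)
colourOf : ∀ {n} → List (Colour n) → Fin n → Colour n
colourOf []      i = ∅
colourOf (c ∷ D) i with lookup c i
... | true  = c
... | false = colourOf D i

data HF (n : ℕ) : Set where
  atom : Fin n → HF n
  set  : List (HF n) → HF n

data _≈_ {n : ℕ} : HF n → HF n → Set where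
  atom≈ : ∀ {i} → atom i ≈ atom i
  set≈  : ∀ {xs ys} →
          All (λ x → Any (λ y → x ≈ y) ys) xs →
          All (λ y → Any (λ x → x ≈ y) xs) ys →
          set xs ≈ set ys

mutual
  actHF : ∀ {n} → Permutation′ n → HF n → HF n
  actHF θ (atom i) = atom (θ ⟨$⟩ʳ i)
  actHF θ (set xs) = set (actHFs θ xs)

  actHFs : ∀ {n} → Permutation′ n → List (HF n) → List (HF n)
  actHFs θ []       = []
  actHFs θ (x ∷ xs) = actHF θ x ∷ actHFs θ xs

Injective : ∀ {k n} → (Fin k → Fin n) → Set
Injective {k} f = (p q : Fin k) → f p ≡ f q → p ≡ q

injective? : ∀ {k n} (f : Fin k → Fin n) → Dec (Injective f)
injective? f = all? (λ p → all? (λ q → (f p FinP.≟ f q) →-dec (p FinP.≟ q)))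

allFuns : ∀ k n → List (Fin k → Fin n)
allFuns zero    n = (λ ()) ∷ []
allFuns (suc k) n =
  concatMap (λ i → map (λ f → λ { zero → i ; (suc p) → f p }) (allFuns k n)) (allFin n)

molecules : ∀ k n → List (Fin k → Fin n)
molecules k n = filter injective? (allFuns k n)

actM : ∀ {k n} → Permutation′ n → (Fin k → Fin n) → (Fin k → Fin n)
actM θ σ p = θ ⟨$⟩ʳ σ p

-- (abstract) 2-configurations
--   positions {0,1} × {0..k-1} are written as two arguments (Fin 2) (Fin k);
--   the equivalence ∼ is given by its Bool-valued characteristic function.

record Config (k n : ℕ) : Set where
  constructor mkConfig
  field
    rel : Fin 2 → Fin k → Fin 2 → Fin k → Bool
    col : Fin 2 → Fin k → Colour n
open Config public

IsConfig : ∀ {k n} → List (Colour n) → Config k n → Set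
IsConfig C E =
  (∀ i p → rel E i p i p ≡ true) ×
  (∀ i p j q → rel E i p j q ≡ true → rel E j q i p ≡ true) ×
  (∀ i p j q l r → rel E i p j q ≡ true → rel E j q l r ≡ true → rel E i p l r ≡ true) ×
  (∀ i p q → (rel E i p i q ≡ true) ⇔ (p ≡ q)) ×
  (∀ i p j q → rel E i p j q ≡ true → col E i p ≡ col E j q) ×
  (∀ i p → col E i p ∈ C)

ConfEq : ∀ {k n} → Config k n → Config k n → Set
ConfEq E E′ = (∀ i p j q → rel E i p j q ≡ rel E′ i p j q) × (∀ i p → col E i p ≡ col E′ i p)

confEq? : ∀ {k n} (E E′ : Config k n) → Dec (ConfEq E E′)
confEq? E E′ =
  all? (λ i → all? (λ p → all? (λ j → all? (λ q → rel E i p j q BoolP.≟ rel E′ i p j q))))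
  ×-dec all? (λ i → all? (λ p → ≡-dec BoolP._≟_ (col E i p) (col E′ i p)))

actE : ∀ {k n} → Permutation′ n → Config k n → Config k n
actE θ E = mkConfig (rel E) (λ i p → actC θ (col E i p))

-- configuration of (τ, σ) with colours read off from the colour list D:
-- conf(τ,σ) = confWith C τ σ,  conf^θ(τ,σ) = confWith θ(C) τ σ
confWith : ∀ {k n} → List (Colour n) → (Fin k → Fin n) → (Fin k → Fin n) → Config k n
confWith D τ σ = mkConfig
  (λ i p j q → does (ρ i p FinP.≟ ρ j q))
  (λ i p → colourOf D (ρ i p))
  where
    ρ : Fin 2 → _
    ρ zero     = τ
    ρ (suc _)  = σ

data Form (k n : ℕ) : Set where
  c    : Fin k → Form k n
  node : List (Form k n × Config k n) → Form k n

data IsForm {k n : ℕ} (C : List (Colour n)) : Form k n → Set where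
  c-form    : ∀ p → IsForm C (c p)
  node-form : ∀ {ps} → All (λ { (φ , E) → IsForm C φ × IsConfig C E }) ps → IsForm C (node ps)

-- generic evaluation: starGen f D φ σ, where a pair (φᵢ, Eᵢ) fires for τ
-- iff f(Eᵢ) = confWith D τ σ.
--   φ * σ      = starGen id      C     φ σ
--   φ *^θ σ    = starGen (actE θ) θ(C) φ σ
mutual
  starGen : ∀ {k n} → (Config k n → Config k n) → List (Colour n) →
            Form k n → (Fin k → Fin n) → HF n
  starGen f D (c p)     σ = atom (σ p)
  starGen f D (node ps) σ = set (starList f D ps σ)

  starList : ∀ {k n} → (Config k n → Config k n) → List (Colour n) →
             List (Form k n × Config k n) → (Fin k → Fin n) → List (HF n)
  starList f D []             σ = []
  starList {k} {n} f D ((φ , E) ∷ ps) σ =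
    starTaus f D φ (filter (λ τ → confEq? (f E) (confWith D τ σ)) (molecules k n))
    ++ starList f D ps σ

  starTaus : ∀ {k n} → (Config k n → Config k n) → List (Colour n) →
             Form k n → List (Fin k → Fin n) → List (HF n)
  starTaus f D φ []       = []
  starTaus f D φ (τ ∷ τs) = starGen f D φ τ ∷ starTaus f D φ τs

star : ∀ {k n} → List (Colour n) → Form k n → (Fin k → Fin n) → HF n
star C φ σ = starGen (λ E → E) C φ σ

starθ : ∀ {k n} → List (Colour n) → Permutation′ n → Form k n → (Fin k → Fin n) → HF n
starθ C θ φ σ = starGen (actE θ) (actCs θ C) φ σ

-- Everything in the definition of φ * σ is equivariant: θ preserves equality of
-- atoms and sends the colour of an atom x in C to the colour of θ x in θ(C), so
-- conf^θ(θτ, θσ) = θ(conf(τ, σ)).  As θ is injective on colours, E fires for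
-- (τ, σ) exactly when θ(E) fires for (θτ, θσ), and τ ↦ θτ is a bijection of
-- k-molecules.  Hence the members of θ(φ * σ) and of φ *^θ θσ correspond, and
-- the claim follows by induction on φ.
module Submission where

open import Defs
open import Data.Nat using (ℕ; _≤_; zero; suc)
open import Data.Fin using (Fin; zero; suc)
open import Data.Fin.Properties using (_≟_)
open import Data.Fin.Permutation using (Permutation′; _⟨$⟩ʳ_; _⟨$⟩ˡ_; inverseˡ; inverseʳ)
open import Data.Fin.Subset using () renaming (⊥ to ∅)
open import Data.Bool using (true; false)
open import Data.Vec using (Vec; lookup)
open import Data.Vec.Properties using (lookup∘tabulate; tabulate∘lookup; tabulate-cong; lookup-replicate)
open import Data.List using (List; []; _∷_; map; filter)
open import Data.List.Membership.Propositional using (_∈_; find; lose)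
open import Data.List.Membership.Propositional.Properties using (∈-filter⁺; ∈-filter⁻; ∈-allFin)
open import Data.List.Relation.Unary.All as All using (All; []; _∷_)
import Data.List.Relation.Unary.All.Properties as All
open import Data.List.Relation.Unary.Any as Any using (Any; here)
import Data.List.Relation.Unary.Any.Properties as Any
open import Data.Product using (_×_; _,_; ∃; proj₂)
open import Function using (id; _∘_; _⇔_; mk⇔; Equivalence)
import Function.Definitions as FD
open import Relation.Nullary using (does)
open import Relation.Nullary.Decidable using (does-⇔)
open import Relation.Binary.PropositionalEquality

private
  variable
    k n : ℕ

vec-ext : ∀ {A : Set} {m} {v w : Vec A m} → (∀ i → lookup v i ≡ lookup w i) → v ≡ w
vec-ext {v = v} {w} h = trans (sym (tabulate∘lookup v)) (trans (tabulate-cong h) (tabulate∘lookup w))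

module _ (θ : Permutation′ n) where

  ⟨$⟩ʳ-injective : FD.Injective _≡_ _≡_ (θ ⟨$⟩ʳ_)
  ⟨$⟩ʳ-injective e = trans (sym (inverseˡ θ)) (trans (cong (θ ⟨$⟩ˡ_) e) (inverseˡ θ))

  ⟨$⟩ˡ-injective : FD.Injective _≡_ _≡_ (θ ⟨$⟩ˡ_)
  ⟨$⟩ˡ-injective e = trans (sym (inverseʳ θ)) (trans (cong (θ ⟨$⟩ʳ_) e) (inverseʳ θ))

  does-≟-act : ∀ {x x′ y y′} → x′ ≡ θ ⟨$⟩ʳ x → y′ ≡ θ ⟨$⟩ʳ y → does (x′ ≟ y′) ≡ does (x ≟ y)
  does-≟-act {x} {y = y} refl refl =
    does-⇔ (mk⇔ ⟨$⟩ʳ-injective (cong (θ ⟨$⟩ʳ_))) (θ ⟨$⟩ʳ x ≟ θ ⟨$⟩ʳ y) (x ≟ y)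

  lookup-actC : ∀ (u : Colour n) x → lookup (actC θ u) (θ ⟨$⟩ʳ x) ≡ lookup u x
  lookup-actC u x = trans (lookup∘tabulate _ (θ ⟨$⟩ʳ x)) (cong (lookup u) (inverseˡ θ))

  actC-injective : FD.Injective _≡_ _≡_ (actC θ)
  actC-injective {u} {u′} e = vec-ext λ x →
    trans (sym (lookup-actC u x)) (trans (cong (λ v → lookup v (θ ⟨$⟩ʳ x)) e) (lookup-actC u′ x))

  actC-∅ : actC θ ∅ ≡ ∅
  actC-∅ = vec-ext λ i → trans (lookup∘tabulate _ i)
    (trans (lookup-replicate (θ ⟨$⟩ˡ i) false) (sym (lookup-replicate i false)))

  colourOf-actCs : ∀ D {x x′} → x′ ≡ θ ⟨$⟩ʳ x → colourOf (actCs θ D) x′ ≡ actC θ (colourOf D x)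
  colourOf-actCs []      refl = sym actC-∅
  colourOf-actCs (u ∷ D) {x} refl rewrite lookup-actC u x with lookup u x
  ... | true  = refl
  ... | false = colourOf-actCs D refl

  ConfEq-trans : {E E′ E″ : Config k n} → ConfEq E E′ → ConfEq E′ E″ → ConfEq E E″
  ConfEq-trans (r , cl) (r′ , cl′) =
    (λ i p j q → trans (r i p j q) (r′ i p j q)) , (λ i p → trans (cl i p) (cl′ i p))

  ConfEq-sym : {E E′ : Config k n} → ConfEq E E′ → ConfEq E′ E
  ConfEq-sym (r , cl) = (λ i p j q → sym (r i p j q)) , (λ i p → sym (cl i p))

  ConfEq-actE : {E E′ : Config k n} → ConfEq E E′ ⇔ ConfEq (actE θ E) (actE θ E′)
  ConfEq-actE = mk⇔ (λ (r , cl) → r , (λ i p → cong (actC θ) (cl i p)))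
                    (λ (r , cl) → r , (λ i p → actC-injective (cl i p)))

  confWith-act : ∀ D {τ τ′ σ σ′ : Fin k → Fin n} → τ′ ≗ actM θ τ → σ′ ≗ actM θ σ →
                 ConfEq (confWith (actCs θ D) τ′ σ′) (actE θ (confWith D τ σ))
  confWith-act D eτ eσ = rel-act , col-act
    where
      rel-act : ∀ i p j q → _
      rel-act zero    p zero    q = does-≟-act (eτ p) (eτ q)
      rel-act zero    p (suc _) q = does-≟-act (eτ p) (eσ q)
      rel-act (suc _) p zero    q = does-≟-act (eσ p) (eτ q)
      rel-act (suc _) p (suc _) q = does-≟-act (eσ p) (eσ q)
      col-act : ∀ i p → _
      col-act zero    p = colourOf-actCs D (eτ p)
      col-act (suc _) p = colourOf-actCs D (eσ p)

  fires-act : ∀ C (E : Config k n) {τ τ′ σ σ′} → τ′ ≗ actM θ τ → σ′ ≗ actM θ σ →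
              ConfEq E (confWith C τ σ) ⇔ ConfEq (actE θ E) (confWith (actCs θ C) τ′ σ′)
  fires-act C E eτ eσ = mk⇔
    (λ E≅ → ConfEq-trans (Equivalence.to ConfEq-actE E≅) (ConfEq-sym conf≅))
    (λ E≅ → Equivalence.from ConfEq-actE (ConfEq-trans E≅ conf≅))
    where conf≅ = confWith-act C eτ eσ

injective-≗ : {f g : Fin k → Fin n} → f ≗ g → Injective g → Injective f
injective-≗ e inj p q h = inj p q (trans (sym (e p)) (trans h (e q)))

injective-∘ : ∀ {m} {g : Fin n → Fin m} {f : Fin k → Fin n} →
              FD.Injective _≡_ _≡_ g → Injective f → Injective (g ∘ f)
injective-∘ g-inj f-inj p q = f-inj p q ∘ g-inj

allFuns-complete : ∀ k n (τ : Fin k → Fin n) → Any (_≗ τ) (allFuns k n)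
allFuns-complete zero    n τ = here (λ ())
allFuns-complete (suc k) n τ = Any.concatMap⁺ _ (lose (∈-allFin (τ zero))
  (Any.map⁺ (Any.map (λ f≗ → λ { zero → refl ; (suc p) → f≗ p }) (allFuns-complete k n (τ ∘ suc)))))

molecules-complete : {τ : Fin k → Fin n} → Injective τ → ∃ λ τ₀ → τ₀ ∈ molecules k n × τ₀ ≗ τ
molecules-complete {k} {n} {τ} inj with find (allFuns-complete k n τ)
... | τ₀ , τ₀∈ , τ₀≗τ = τ₀ , ∈-filter⁺ injective? τ₀∈ (injective-≗ τ₀≗τ inj) , τ₀≗τ

molecules-injective : {τ : Fin k → Fin n} → τ ∈ molecules k n → Injective τ
molecules-injective {k} {n} = proj₂ ∘ ∈-filter⁻ injective? {xs = allFuns k n}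

firing : Config k n → List (Colour n) → (Fin k → Fin n) → List (Fin k → Fin n)
firing {k} {n} E D σ = filter (λ τ → confEq? E (confWith D τ σ)) (molecules k n)

module _ (θ : Permutation′ n) (C : List (Colour n)) (E : Config k n)
         {σ σ′ : Fin k → Fin n} (σ′≗θσ : σ′ ≗ actM θ σ) where

  firing-act⁺ : ∀ {τ} → τ ∈ firing E C σ →
                ∃ λ τ′ → τ′ ∈ firing (actE θ E) (actCs θ C) σ′ × τ′ ≗ actM θ τ
  firing-act⁺ τ∈ with ∈-filter⁻ (λ τ → confEq? E (confWith C τ σ)) τ∈
  ... | τ-mol , fires with molecules-complete (injective-∘ (⟨$⟩ʳ-injective θ) (molecules-injective τ-mol))
  ... | τ′ , τ′-mol , τ′≗θτ =
    τ′ , ∈-filter⁺ _ τ′-mol (Equivalence.to (fires-act θ C E τ′≗θτ σ′≗θσ) fires) , τ′≗θτ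

  firing-act⁻ : ∀ {τ′} → τ′ ∈ firing (actE θ E) (actCs θ C) σ′ →
                ∃ λ τ → τ ∈ firing E C σ × τ′ ≗ actM θ τ
  firing-act⁻ {τ′} τ′∈ with ∈-filter⁻ (λ τ′ → confEq? (actE θ E) (confWith (actCs θ C) τ′ σ′)) τ′∈
  ... | τ′-mol , fires with molecules-complete (injective-∘ (⟨$⟩ˡ-injective θ) (molecules-injective τ′-mol))
  ... | τ , τ-mol , τ≗θ⁻¹τ′ =
    τ , ∈-filter⁺ _ τ-mol (Equivalence.from (fires-act θ C E τ′≗θτ σ′≗θσ) fires) , τ′≗θτ
    where
      τ′≗θτ : τ′ ≗ actM θ τ
      τ′≗θτ p = trans (sym (inverseʳ θ)) (cong (θ ⟨$⟩ʳ_) (sym (τ≗θ⁻¹τ′ p)))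

starTaus≡map : ∀ f D (φ : Form k n) τs → starTaus f D φ τs ≡ map (starGen f D φ) τs
starTaus≡map f D φ []       = refl
starTaus≡map f D φ (τ ∷ τs) = cong (_ ∷_) (starTaus≡map f D φ τs)

actHFs≡map : ∀ (θ : Permutation′ n) xs → actHFs θ xs ≡ map (actHF θ) xs
actHFs≡map θ []       = refl
actHFs≡map θ (x ∷ xs) = cong (_ ∷_) (actHFs≡map θ xs)

module _ (θ : Permutation′ n) (C : List (Colour n)) where

  module _ (φ : Form k n) (E : Config k n)
           (φ-act : ∀ {τ τ′} → τ′ ≗ actM θ τ → actHF θ (star C φ τ) ≈ starθ C θ φ τ′)
           {σ σ′ : Fin k → Fin n} (σ′≗θσ : σ′ ≗ actM θ σ) where

    starTaus-act⁺ : All (λ x → Any (actHF θ x ≈_) (starTaus (actE θ) (actCs θ C) φ (firing (actE θ E) (actCs θ C) σ′)))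
                        (starTaus id C φ (firing E C σ))
    starTaus-act⁺ rewrite starTaus≡map id C φ (firing E C σ)
                        | starTaus≡map (actE θ) (actCs θ C) φ (firing (actE θ E) (actCs θ C) σ′) =
      All.map⁺ (All.tabulate λ τ∈ → let τ′ , τ′∈ , τ′≗θτ = firing-act⁺ θ C E σ′≗θσ τ∈ in
        Any.map⁺ (lose τ′∈ (φ-act τ′≗θτ)))

    starTaus-act⁻ : All (λ y → Any (λ x → actHF θ x ≈ y) (starTaus id C φ (firing E C σ)))
                        (starTaus (actE θ) (actCs θ C) φ (firing (actE θ E) (actCs θ C) σ′))
    starTaus-act⁻ rewrite starTaus≡map id C φ (firing E C σ)
                        | starTaus≡map (actE θ) (actCs θ C) φ (firing (actE θ E) (actCs θ C) σ′) =
      All.map⁺ (All.tabulate λ τ′∈ → let τ , τ∈ , τ′≗θτ = firing-act⁻ θ C E σ′≗θσ τ′∈ in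
        Any.map⁺ (lose τ∈ (φ-act τ′≗θτ)))

  -- Generalised from θσ to any σ′ ≗ θσ: the list of molecules contains θτ only
  -- up to pointwise equality, and there is no function extensionality.
  mutual
    star-act : ∀ (φ : Form k n) {σ σ′} → σ′ ≗ actM θ σ → actHF θ (star C φ σ) ≈ starθ C θ φ σ′
    star-act (c p)     e = subst (λ x → atom _ ≈ atom x) (sym (e p)) atom≈
    star-act (node ps) {σ} e rewrite actHFs≡map θ (starList id C ps σ) =
      set≈ (All.map⁺ (starList-act⁺ ps e)) (All.map Any.map⁺ (starList-act⁻ ps e))

    starList-act⁺ : ∀ (ps : List (Form k n × Config k n)) {σ σ′} → σ′ ≗ actM θ σ →
      All (λ x → Any (actHF θ x ≈_) (starList (actE θ) (actCs θ C) ps σ′)) (starList id C ps σ)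
    starList-act⁺ []             e = []
    starList-act⁺ ((φ , E) ∷ ps) e = All.++⁺ (All.map Any.++⁺ˡ (starTaus-act⁺ φ E (star-act φ) e))
                                             (All.map (Any.++⁺ʳ _) (starList-act⁺ ps e))

    starList-act⁻ : ∀ (ps : List (Form k n × Config k n)) {σ σ′} → σ′ ≗ actM θ σ →
      All (λ y → Any (λ x → actHF θ x ≈ y) (starList id C ps σ)) (starList (actE θ) (actCs θ C) ps σ′)
    starList-act⁻ []             e = []
    starList-act⁻ ((φ , E) ∷ ps) e = All.++⁺ (All.map Any.++⁺ˡ (starTaus-act⁻ φ E (star-act φ) e))
                                             (All.map (Any.++⁺ʳ _) (starList-act⁻ ps e))

-- Equivariance needs none of the partition, well-formedness, injectivity or 1 ≤ k hypotheses.
lemma8 : (n k : ℕ) → 1 ≤ k → (C : List (Colour n)) → IsPartition C →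
    (θ : Permutation′ n) (φ : Form k n) → IsForm C φ →
    (σ : Fin k → Fin n) → Injective σ →
    actHF θ (star C φ σ) ≈ starθ C θ φ (actM θ σ)
lemma8 n k _ C _ θ φ _ σ _ = star-act θ C φ (λ _ → refl)
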